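{- Let $n$ be odd with $2n+1$ prime, and let $g$ be a primitive root modulo $2n+1$. For $i = 1, 2, \ldots, n$ let $c_i \in \mathbb{Z}_{2n}$ be the discrete logarithm of $i$ to base $g$ (i.e. $g^{c_i} \equiv i \pmod{2n+1}$), and let $d_i \in \mathbb{Z}_n$ be the reduction of $c_i$ modulo $n$. Then $(d_1, d_2, \ldots, d_n)$ is a terrace for $\mathbb{Z}_n$.
   Context: Write $n = 2m+1$ and view the vertices of $K_n$ as the elements of the cyclic group $\mathbb{Z}_n=\{0,1,\dots,n-1\}$. The length of the edge between vertices $x$ and $y$ is the set $\{y-x, x-y\} = \pm(y-x)$. A Hamiltonian path in $K_n$ (equivalently, an arrangement $(h_1,\dots,h_n)$ of all elements of $\mathbb{Z}_n$, with edges $\{h_t,h_{t+1}\}$) is a terrace for $\mathbb{Z}_n$ if each edge length $\pm \ell$, for $\ell \in \{1, 2, \ldots, m\}$, occurs exactly twice among its $n-1$ edges. -}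

module Defs where

open import Data.Nat using (ℕ; zero; suc; _+_; _*_; _∸_; _^_; _<_; _≤_; _%_; _≡ᵇ_)
open import Data.Bool using (Bool; true; false; if_then_else_; _∨_)
open import Data.Fin using (Fin; toℕ; inject₁) renaming (suc to fsuc)
open import Data.List using (List; map; allFin)
open import Data.Nat.ListAction using (sum)
open import Data.Product using (_×_)
open import Relation.Binary.PropositionalEquality using (_≡_; _≢_)

-- Z_n with n = 2m+1 is modelled by the naturals 0..n-1, arithmetic mod n.

IsArrangement : (m : ℕ) → (Fin (suc (2 * m)) → ℕ) → Set
IsArrangement m h = ((t : Fin (suc (2 * m))) → h t < suc (2 * m))
                  × ((s t : Fin (suc (2 * m))) → h s ≡ h t → s ≡ t)

hasLength : (m : ℕ) → ℕ → ℕ → ℕ → Bool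
hasLength m ℓ x y = (((y + suc (2 * m)) ∸ x) % suc (2 * m) ≡ᵇ ℓ)
                  ∨ (((x + suc (2 * m)) ∸ y) % suc (2 * m) ≡ᵇ ℓ)

edgeCount : (m : ℕ) → (Fin (suc (2 * m)) → ℕ) → ℕ → ℕ
edgeCount m h ℓ =
  sum (map (λ t → if hasLength m ℓ (h (inject₁ t)) (h (fsuc t)) then 1 else 0)
           (allFin (2 * m)))

Terrace : (m : ℕ) → (Fin (suc (2 * m)) → ℕ) → Set
Terrace m h = IsArrangement m h
            × ((ℓ : ℕ) → 1 ≤ ℓ → ℓ ≤ m → edgeCount m h ℓ ≡ 2)

PrimitiveRoot : (p : ℕ) → ℕ → Set
PrimitiveRoot zero g = g ≡ g   -- unused (p is prime below)
PrimitiveRoot (suc q) g =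
  (g ^ q % suc q ≡ 1 % suc q) × ((k : ℕ) → 1 ≤ k → k < q → g ^ k % suc q ≢ 1 % suc q)

module Submission where

-- Work in ℤ/p, p = 2n + 1.  Since g has order 2n, g^a ≡ ±g^b iff g^(2a) ≡ g^(2b) iff
-- a ≡ b (mod n).  Hence d s = d t gives s + 1 ≡ ±(t + 1), so s = t; and, with y = g^ℓ, the
-- edge between the values i and i + 1 has length ±ℓ iff (i + 1)/i ∈ {y, -y, 1/y, -1/y}.
-- For z ≢ 0, ±1 the equation (v + 1)/v = z has one solution v, which is neither 0, n nor
-- 2n, and i ↦ 2n - i (that is, i ↦ -(i + 1)) exchanges (i + 1)/i = z with i/(i + 1) = z;
-- so exactly one i ∈ {1, …, n - 1} has (i + 1)/i ∈ {z, 1/z}.  The values of i found for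
-- z = y and z = -y differ because y² ≢ -1 (the order 2n of g does not divide 4ℓ), so every
-- length ±ℓ occurs exactly twice.

open import Data.Bool using (Bool; true; false; if_then_else_; T)
open import Data.Bool.Properties using (T-∨)
open import Data.Fin using (Fin; toℕ; inject₁) renaming (zero to fzero; suc to fsuc)
open import Data.Fin.Properties using (toℕ-injective; toℕ-inject₁; toℕ<n)
open import Data.Integer using (ℤ; +_; -_; 0ℤ; 1ℤ; ∣_∣)
import Data.Integer.Properties as ℤₚ
open import Data.Integer.DivMod using (_%ℕ_; _/ℕ_; n%ℕd<d; a≡a%ℕn+[a/ℕn]*n)
open import Data.Integer.Divisibility.Signed
  using (_∣_; divides; ∣-refl; ∣⇒∣ᵤ; ∣ᵤ⇒∣; ∣m∣n⇒∣m+n; ∣m∣n⇒∣m-n; ∣m⇒∣-m; ∣m⇒∣m*n; ∣n⇒∣m*n;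
         ∣m+n∣m⇒∣n; ∣m+n∣n⇒∣m)
open import Data.Integer.Tactic.RingSolver using (solve-∀)
open import Data.List using (map; allFin)
open import Data.List.Properties using (map-tabulate)
open import Data.Nat as ℕ using (ℕ; zero; suc; NonZero; _<_; _≤_; z≤n; s≤s; _%_; _/_)
import Data.Nat.Properties as ℕ
import Data.Nat.DivMod as ℕ
import Data.Nat.Divisibility as ℕ
open import Data.Nat.ListAction using (sum)
open import Data.Nat.Primality using (Prime; euclidsLemma; prime⇒nonZero; prime⇒nonTrivial)
open import Data.Nat.Coprimality using (prime⇒coprime; coprime-Bézout)
open import Data.Nat.GCD using (module Bézout)
open import Data.Product as Product using (∃-syntax; _×_; _,_; proj₁; proj₂)
open import Data.Sum as Sum using (_⊎_; inj₁; inj₂; [_,_]′)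
open import Data.Sum.Function.Propositional using (_⊎-⇔_)
open import Function using (_∘_; id; flip; _⇔_; mk⇔; Equivalence)
open import Function.Properties.Equivalence using (⇔-setoid)
open import Level using (0ℓ)
open import Relation.Binary.Bundles using (Setoid)
open import Relation.Binary.Structures using (IsEquivalence)
import Relation.Binary.Reasoning.Setoid
open import Relation.Binary.Definitions using (tri<; tri≈; tri>)
open import Relation.Binary.PropositionalEquality
open import Relation.Nullary using (¬_; contradiction)

open import Defs

open Equivalence using (to; from)

module ⇔-Reasoning = Relation.Binary.Reasoning.Setoid (⇔-setoid 0ℓ)

≡ᵇ⇔≡ : ∀ {x y} → T (x ℕ.≡ᵇ y) ⇔ x ≡ y
≡ᵇ⇔≡ {x} {y} = mk⇔ (ℕ.≡ᵇ⇒≡ x y) (ℕ.≡⇒≡ᵇ x y)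

⊎-interchange : ∀ {A B C D : Set} → ((A ⊎ B) ⊎ (C ⊎ D)) ⇔ ((A ⊎ C) ⊎ (B ⊎ D))
⊎-interchange = mk⇔ [ Sum.map inj₁ inj₁ , Sum.map inj₂ inj₂ ]′ [ Sum.map inj₁ inj₁ , Sum.map inj₂ inj₂ ]′

count : ∀ {K} → (Fin K → Bool) → ℕ
count {K} b = sum (map (λ t → if b t then 1 else 0) (allFin K))

private
  indicator-true : ∀ {x} → T x → (if x then 1 else 0) ≡ 1
  indicator-true {true} _ = refl

  indicator-false : ∀ {x} → ¬ T x → (if x then 1 else 0) ≡ 0
  indicator-false {false} _ = refl
  indicator-false {true} ¬⊤ = contradiction _ ¬⊤

count-suc : ∀ {K} (b : Fin (suc K) → Bool) →
            count b ≡ (if b fzero then 1 else 0) ℕ.+ count (b ∘ fsuc)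
count-suc {K} b = cong (λ xs → f fzero ℕ.+ sum xs)
  (trans (map-tabulate {n = K} fsuc f) (sym (map-tabulate id (f ∘ fsuc))))
  where f = λ t → if b t then 1 else 0

count≡0 : ∀ {K} (b : Fin K → Bool) → (∀ t → ¬ T (b t)) → count b ≡ 0
count≡0 {zero}  b none = refl
count≡0 {suc K} b none =
  trans (count-suc b) (cong₂ ℕ._+_ (indicator-false (none fzero)) (count≡0 (b ∘ fsuc) (none ∘ fsuc)))

count≡1 : ∀ {K} (b : Fin K → Bool) {x} → x < K → (∀ t → T (b t) ⇔ toℕ t ≡ x) → count b ≡ 1
count≡1 {suc K} b {zero} _ holds = trans (count-suc b) (cong₂ ℕ._+_
  (indicator-true (from (holds fzero) refl))
  (count≡0 (b ∘ fsuc) (λ t → ℕ.1+n≢0 ∘ to (holds (fsuc t)))))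
count≡1 {suc K} b {suc x} (s≤s x<K) holds = trans (count-suc b) (cong₂ ℕ._+_
  (indicator-false (ℕ.0≢1+n ∘ to (holds fzero)))
  (count≡1 (b ∘ fsuc) x<K (λ t → mk⇔ (ℕ.suc-injective ∘ to (holds (fsuc t))) (from (holds (fsuc t)) ∘ cong suc))))

count≡2 : ∀ {K} (b : Fin K → Bool) {x y} → x ≢ y → x < K → y < K →
          (∀ t → T (b t) ⇔ (toℕ t ≡ x ⊎ toℕ t ≡ y)) → count b ≡ 2
count≡2 {suc K} b {zero} {zero} x≢y _ _ _ = contradiction refl x≢y
count≡2 {suc K} b {zero} {suc y} _ _ (s≤s y<K) holds = trans (count-suc b) (cong₂ ℕ._+_
  (indicator-true (from (holds fzero) (inj₁ refl)))
  (count≡1 (b ∘ fsuc) y<K (λ t → mk⇔ ([ (λ ()) , ℕ.suc-injective ]′ ∘ to (holds (fsuc t)))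
                                     (from (holds (fsuc t)) ∘ inj₂ ∘ cong suc))))
count≡2 {suc K} b {suc x} {zero} _ (s≤s x<K) _ holds = trans (count-suc b) (cong₂ ℕ._+_
  (indicator-true (from (holds fzero) (inj₂ refl)))
  (count≡1 (b ∘ fsuc) x<K (λ t → mk⇔ ([ ℕ.suc-injective , (λ ()) ]′ ∘ to (holds (fsuc t)))
                                     (from (holds (fsuc t)) ∘ inj₁ ∘ cong suc))))
count≡2 {suc K} b {suc x} {suc y} x≢y (s≤s x<K) (s≤s y<K) holds = trans (count-suc b) (cong₂ ℕ._+_
  (indicator-false ([ ℕ.0≢1+n , ℕ.0≢1+n ]′ ∘ to (holds fzero)))
  (count≡2 (b ∘ fsuc) (x≢y ∘ cong suc) x<K y<K
    (λ t → mk⇔ (Sum.map ℕ.suc-injective ℕ.suc-injective ∘ to (holds (fsuc t)))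
               (from (holds (fsuc t)) ∘ Sum.map (cong suc) (cong suc)))))

private
  m+m≡2*m : ∀ m → m ℕ.+ m ≡ 2 ℕ.* m
  m+m≡2*m m = cong (m ℕ.+_) (sym (ℕ.+-identityʳ m))

module Modulo (P : ℕ) where

  open import Data.Integer using (_+_; _-_; _*_)

  private
    variable a b c d : ℤ

    m+n-m≡n : ∀ m n → m + n - m ≡ n
    m+n-m≡n = solve-∀

  infix 4 _≈_ _≉_
  -- A record rather than the bare divisibility, so that a and b can be inferred.
  record _≈_ (a b : ℤ) : Set where
    constructor mk≈
    field difference : + P ∣ a - b

  _≉_ : ℤ → ℤ → Set
  a ≉ b = ¬ a ≈ b

  ≡⇒≈ : a ≡ b → a ≈ b
  ≡⇒≈ {a} refl = mk≈ (divides 0ℤ (ℤₚ.+-inverseʳ a))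

  ≈-refl : a ≈ a
  ≈-refl = ≡⇒≈ refl

  ≈-sym : a ≈ b → b ≈ a
  ≈-sym {a} {b} (mk≈ P∣a-b) = mk≈ (subst (+ P ∣_) (negate a b) (∣m⇒∣-m P∣a-b))
    where negate : ∀ a b → - (a - b) ≡ b - a
          negate = solve-∀

  ≈-trans : a ≈ b → b ≈ c → a ≈ c
  ≈-trans {a} {b} {c} (mk≈ P∣a-b) (mk≈ P∣b-c) =
    mk≈ (subst (+ P ∣_) (telescope a b c) (∣m∣n⇒∣m+n P∣a-b P∣b-c))
    where telescope : ∀ a b c → (a - b) + (b - c) ≡ a - c
          telescope = solve-∀

  ≈-isEquivalence : IsEquivalence _≈_
  ≈-isEquivalence = record { refl = ≈-refl ; sym = ≈-sym ; trans = ≈-trans }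

  ≈-setoid : Setoid 0ℓ 0ℓ
  ≈-setoid = record { isEquivalence = ≈-isEquivalence }

  module ≈-Reasoning = Relation.Binary.Reasoning.Setoid ≈-setoid

  ≈-resp : ∀ {a a′ b b′} → a ≈ a′ → b ≈ b′ → (a ≈ b ⇔ a′ ≈ b′)
  ≈-resp a≈a′ b≈b′ = mk⇔ (λ a≈b → ≈-trans (≈-sym a≈a′) (≈-trans a≈b b≈b′))
                         (λ a′≈b′ → ≈-trans a≈a′ (≈-trans a′≈b′ (≈-sym b≈b′)))

  +-cong : a ≈ b → c ≈ d → a + c ≈ b + d
  +-cong {a} {b} {c} {d} (mk≈ P∣a-b) (mk≈ P∣c-d) =
    mk≈ (subst (+ P ∣_) (regroup a b c d) (∣m∣n⇒∣m+n P∣a-b P∣c-d))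
    where regroup : ∀ a b c d → (a - b) + (c - d) ≡ (a + c) - (b + d)
          regroup = solve-∀

  -‿cong : a ≈ b → - a ≈ - b
  -‿cong {a} {b} (mk≈ P∣a-b) = mk≈ (subst (+ P ∣_) (negate a b) (∣m⇒∣-m P∣a-b))
    where negate : ∀ a b → - (a - b) ≡ - a - - b
          negate = solve-∀

  *-cong : a ≈ b → c ≈ d → a * c ≈ b * d
  *-cong {a} {b} {c} {d} (mk≈ P∣a-b) (mk≈ P∣c-d) =
    mk≈ (subst (+ P ∣_) (regroup a b c d) (∣m∣n⇒∣m+n (∣m⇒∣m*n c P∣a-b) (∣n⇒∣m*n b P∣c-d)))
    where regroup : ∀ a b c d → (a - b) * c + b * (c - d) ≡ a * c - b * d
          regroup = solve-∀

  +-cancelʳ : a + c ≈ b + c → a ≈ b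
  +-cancelʳ {a} {c} {b} (mk≈ P∣a+c-b+c) = mk≈ (subst (+ P ∣_) (cancel a b c) P∣a+c-b+c)
    where cancel : ∀ a b c → (a + c) - (b + c) ≡ a - b
          cancel = solve-∀

  ∣⇒≈0 : + P ∣ a → a ≈ 0ℤ
  ∣⇒≈0 {a} P∣a = mk≈ (subst (+ P ∣_) (sym (ℤₚ.+-identityʳ a)) P∣a)

  ≈0⇒∣ : a ≈ 0ℤ → + P ∣ a
  ≈0⇒∣ {a} (mk≈ P∣a-0) = subst (+ P ∣_) (ℤₚ.+-identityʳ a) P∣a-0

  difference≈0⇒≈ : a - b ≈ 0ℤ → a ≈ b
  difference≈0⇒≈ = mk≈ ∘ ≈0⇒∣

  module _ .{{_ : NonZero P}} where

    %-≈ : ∀ x → + (x % P) ≈ + x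
    %-≈ x = ≈-sym (mk≈ (divides (+ (x / P)) (begin
      + x - + (x % P)                          ≡⟨ cong (λ u → + u - + (x % P)) (ℕ.m≡m%n+[m/n]*n x P) ⟩
      + (x % P ℕ.+ x / P ℕ.* P) - + (x % P)    ≡⟨ cong (λ u → + (x % P) + u - + (x % P)) (ℤₚ.pos-* (x / P) P) ⟩
      + (x % P) + + (x / P) * + P - + (x % P)  ≡⟨ m+n-m≡n (+ (x % P)) (+ (x / P) * + P) ⟩
      + (x / P) * + P                          ∎)))
      where open ≡-Reasoning

    %≡⇒≈ : ∀ {x y} → x % P ≡ y % P → + x ≈ + y
    %≡⇒≈ {x} {y} eq = ≈-trans (≈-sym (%-≈ x)) (≈-trans (≡⇒≈ (cong +_ eq)) (%-≈ y))

    ≈⇒%≡ : ∀ {x y} → + x ≈ + y → x % P ≡ y % P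
    ≈⇒%≡ {x} {y} x≈y =
      [ (λ y≤x → ≥⇒%≡ y≤x x≈y) , (λ x≤y → sym (≥⇒%≡ x≤y (≈-sym x≈y))) ]′ (ℕ.≤-total y x)
      where
        ≥⇒%≡ : ∀ {x y} → y ≤ x → + x ≈ + y → x % P ≡ y % P
        ≥⇒%≡ {x} {y} y≤x (mk≈ P∣x-y) = begin
          x % P                ≡⟨ ℕ.%-congˡ (ℕ.m∸n+n≡m y≤x) ⟨
          (x ℕ.∸ y ℕ.+ y) % P  ≡⟨ ℕ.%-remove-+ˡ y P∣x∸y ⟩
          y % P                ∎
          where
            open ≡-Reasoning
            P∣x∸y : P ℕ.∣ x ℕ.∸ y
            P∣x∸y = ∣⇒∣ᵤ (subst (+ P ∣_) (trans (ℤₚ.m-n≡m⊖n x y) (ℤₚ.⊖-≥ y≤x)) P∣x-y)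

    residue : ∀ a → ∃[ r ] r < P × a ≈ + r
    residue a = a %ℕ P , n%ℕd<d a P , mk≈ (divides (a /ℕ P) (begin
      a - + (a %ℕ P)                            ≡⟨ cong (_- + (a %ℕ P)) (a≡a%ℕn+[a/ℕn]*n a P) ⟩
      + (a %ℕ P) + (a /ℕ P) * + P - + (a %ℕ P)  ≡⟨ m+n-m≡n (+ (a %ℕ P)) ((a /ℕ P) * + P) ⟩
      (a /ℕ P) * + P                            ∎))
      where open ≡-Reasoning

    ≈-injective-below : ∀ {x y} → x < P → y < P → + x ≈ + y → x ≡ y
    ≈-injective-below {x} {y} x<P y<P x≈y =
      trans (sym (ℕ.m<n⇒m%n≡m x<P)) (trans (≈⇒%≡ x≈y) (ℕ.m<n⇒m%n≡m y<P))

    positive-below-≉0 : ∀ {x} → 0 < x → x < P → + x ≉ 0ℤ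
    positive-below-≉0 {suc x} _ x<P x≈0 with () ← ≈-injective-below x<P (ℕ.<-trans (s≤s z≤n) x<P) x≈0

    ±-injective : ∀ {x y} → x ℕ.+ y < P → + x ≈ + y ⊎ + x ≈ - + y → x ≡ y
    ±-injective {x} {y} x+y<P (inj₁ x≈y) =
      ≈-injective-below (ℕ.≤-<-trans (ℕ.m≤m+n x y) x+y<P) (ℕ.≤-<-trans (ℕ.m≤n+m y x) x+y<P) x≈y
    ±-injective {x} {y} x+y<P (inj₂ x≈-y) =
      trans (ℕ.m+n≡0⇒m≡0 x x+y≡0) (sym (ℕ.m+n≡0⇒n≡0 x x+y≡0))
      where
        x+y≡0 : x ℕ.+ y ≡ 0
        x+y≡0 = ≈-injective-below x+y<P (ℕ.≤-<-trans z≤n x+y<P)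
          (≈-trans (+-cong x≈-y ≈-refl) (≡⇒≈ (ℤₚ.+-inverseˡ (+ y))))

    %-difference⇔ : ∀ A B {ℓ} → ℓ < P →
                    ((B % P ℕ.+ P) ℕ.∸ A % P) % P ≡ ℓ ⇔ B % P ≡ (A ℕ.+ ℓ) % P
    %-difference⇔ A B {ℓ} ℓ<P = mk⇔
      (λ D%P≡ℓ → ≈⇒%≡ {B} {A ℕ.+ ℓ} (begin
        + B            ≈⟨ D+A≈B ⟨
        + D + + A      ≈⟨ +-cong {c = + A} (%≡⇒≈ {D} {ℓ} (trans D%P≡ℓ (sym ℓ%P≡ℓ))) ≈-refl ⟩
        + ℓ + + A      ≡⟨ ℤₚ.+-comm (+ ℓ) (+ A) ⟩
        + (A ℕ.+ ℓ)    ∎))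
      (λ B≡A+ℓ → trans (≈⇒%≡ {D} {ℓ} (+-cancelʳ {c = + A} (begin
        + D + + A      ≈⟨ D+A≈B ⟩
        + B            ≈⟨ %≡⇒≈ {B} {A ℕ.+ ℓ} B≡A+ℓ ⟩
        + A + + ℓ      ≡⟨ ℤₚ.+-comm (+ A) (+ ℓ) ⟩
        + ℓ + + A      ∎))) ℓ%P≡ℓ)
      where
        open ≈-Reasoning
        D = (B % P ℕ.+ P) ℕ.∸ A % P
        ℓ%P≡ℓ : ℓ % P ≡ ℓ
        ℓ%P≡ℓ = ℕ.m<n⇒m%n≡m ℓ<P
        D+A≈B : + D + + A ≈ + B
        D+A≈B = begin
          + D + + A            ≈⟨ +-cong {a = + D} ≈-refl (%-≈ A) ⟨
          + (D ℕ.+ A % P)      ≡⟨ cong +_ (ℕ.m∸n+n≡m (ℕ.≤-trans (ℕ.m%n≤n A P) (ℕ.m≤n+m P (B % P)))) ⟩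
          + (B % P ℕ.+ P)      ≈⟨ %≡⇒≈ {B % P ℕ.+ P} {B} (trans (ℕ.[m+n]%n≡m%n (B % P) P) (ℕ.m%n%n≡m%n B P)) ⟩
          + B                  ∎

  module _ (isPrime : Prime P) where

    private instance
      P-nonZero : NonZero P
      P-nonZero = prime⇒nonZero isPrime

    ≈0-product : a * b ≈ 0ℤ → a ≈ 0ℤ ⊎ b ≈ 0ℤ
    ≈0-product {a} {b} ab≈0 = Sum.map (∣⇒≈0 ∘ ∣ᵤ⇒∣) (∣⇒≈0 ∘ ∣ᵤ⇒∣)
      (euclidsLemma ∣ a ∣ ∣ b ∣ isPrime (subst (P ℕ.∣_) (ℤₚ.abs-* a b) (∣⇒∣ᵤ (≈0⇒∣ ab≈0))))

    *-cancelˡ : a ≉ 0ℤ → a * b ≈ a * c → b ≈ c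
    *-cancelˡ {a} {b} {c} a≉0 (mk≈ P∣ab-ac) =
      [ flip contradiction a≉0 , difference≈0⇒≈ ]′
        (≈0-product (∣⇒≈0 (subst (+ P ∣_) (factor a b c) P∣ab-ac)))
      where factor : ∀ a b c → a * b - a * c ≡ a * (b - c)
            factor = solve-∀

    square-≈⇔ : a * a ≈ b * b ⇔ (a ≈ b ⊎ a ≈ - b)
    square-≈⇔ {a} {b} = mk⇔
      (λ (mk≈ P∣a²-b²) → Sum.map difference≈0⇒≈ difference≈0⇒≈
        (≈0-product (∣⇒≈0 (subst (+ P ∣_) (factor a b) P∣a²-b²))))
      [ (λ a≈b → *-cong a≈b a≈b) , (λ a≈-b → ≈-trans (*-cong a≈-b a≈-b) (≡⇒≈ (neg-square b))) ]′
      where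
        factor : ∀ a b → a * a - b * b ≡ (a - b) * (a - - b)
        factor = solve-∀
        neg-square : ∀ b → - b * - b ≡ b * b
        neg-square = solve-∀

    inverse : a ≉ 0ℤ → ∃[ w ] a * w ≈ 1ℤ
    inverse {a} a≉0 with residue a
    ... | zero , _ , a≈0 = contradiction a≈0 a≉0
    ... | r@(suc _) , r<P , a≈r =
      Product.map₂ (≈-trans (*-cong a≈r ≈-refl)) (bézout (coprime-Bézout (prime⇒coprime isPrime r<P)))
      where
        open ≡-Reasoning
        bézout : Bézout.Identity 1 P r → ∃[ w ] + r * w ≈ 1ℤ
        bézout (Bézout.+- x y eq) = - + y , mk≈ (divides (- + x) (begin
          + r * - + y - 1ℤ       ≡⟨ negate (+ r) (+ y) ⟩
          - (1ℤ + + y * + r)     ≡⟨ cong (λ u → - (1ℤ + u)) (ℤₚ.pos-* y r) ⟨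
          - + (1 ℕ.+ y ℕ.* r)    ≡⟨ cong (-_ ∘ +_) eq ⟩
          - + (x ℕ.* P)          ≡⟨ cong -_ (ℤₚ.pos-* x P) ⟩
          - (+ x * + P)          ≡⟨ ℤₚ.neg-distribˡ-* (+ x) (+ P) ⟩
          - + x * + P            ∎))
          where negate : ∀ r y → r * - y - 1ℤ ≡ - (1ℤ + y * r)
                negate = solve-∀
        bézout (Bézout.-+ x y eq) = + y , mk≈ (divides (+ x) (begin
          + r * + y - 1ℤ         ≡⟨ cong (_- 1ℤ) (ℤₚ.*-comm (+ r) (+ y)) ⟩
          + y * + r - 1ℤ         ≡⟨ cong (_- 1ℤ) (ℤₚ.pos-* y r) ⟨
          + (y ℕ.* r) - 1ℤ       ≡⟨ cong (λ u → + u - 1ℤ) eq ⟨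
          1ℤ + + (x ℕ.* P) - 1ℤ  ≡⟨ m+n-m≡n 1ℤ (+ (x ℕ.* P)) ⟩
          + (x ℕ.* P)            ≡⟨ ℤₚ.pos-* x P ⟩
          + x * + P              ∎))

module PrimitiveRootPowers (n : ℕ) .{{_ : NonZero n}} (isPrime : Prime (suc (2 ℕ.* n)))
                           (g : ℕ) (root : PrimitiveRoot (suc (2 ℕ.* n)) g) where

  open import Data.Integer using (_*_)
  open Modulo (suc (2 ℕ.* n))

  q : ℕ
  q = 2 ℕ.* n

  private instance
    q-nonZero : NonZero q
    q-nonZero = ℕ.m*n≢0 2 n

  %-double⇔ : ∀ a b → a % n ≡ b % n ⇔ 2 ℕ.* a % q ≡ 2 ℕ.* b % q
  %-double⇔ a b = mk⇔ (λ eq → trans (double-% a) (trans (cong (2 ℕ.*_) eq) (sym (double-% b))))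
                      (λ eq → ℕ.*-cancelˡ-≡ _ _ 2 (trans (sym (double-% a)) (trans eq (double-% b))))
    where
      instance
        n*2-nonZero : NonZero (n ℕ.* 2)
        n*2-nonZero = ℕ.m*n≢0 n 2
      double-% : ∀ x → 2 ℕ.* x % q ≡ 2 ℕ.* (x % n)
      double-% x = begin
        2 ℕ.* x % q        ≡⟨ ℕ.%-congˡ {o = q} (ℕ.*-comm 2 x) ⟩
        x ℕ.* 2 % q        ≡⟨ ℕ.%-congʳ (ℕ.*-comm 2 n) ⟩
        x ℕ.* 2 % (n ℕ.* 2) ≡⟨ ℕ.m%n*o≡m*o%[n*o] x n 2 ⟨
        x % n ℕ.* 2        ≡⟨ ℕ.*-comm (x % n) 2 ⟩
        2 ℕ.* (x % n)      ∎
        where open ≡-Reasoning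

  pow : ℕ → ℤ
  pow k = + (g ℕ.^ k)

  pow-+ : ∀ a b → pow (a ℕ.+ b) ≡ pow a * pow b
  pow-+ a b = trans (cong +_ (ℕ.^-distribˡ-+-* g a b)) (ℤₚ.pos-* (g ℕ.^ a) (g ℕ.^ b))

  pow-double : ∀ a → pow (2 ℕ.* a) ≡ pow a * pow a
  pow-double a = trans (cong (pow ∘ (a ℕ.+_)) (ℕ.+-identityʳ a)) (pow-+ a a)

  pow-+-cong : ∀ {b w} ℓ → pow b ≈ w → pow (b ℕ.+ ℓ) ≈ pow ℓ * w
  pow-+-cong {b} {w} ℓ pow-b≈w =
    ≈-trans (≡⇒≈ (pow-+ b ℓ)) (≈-trans (*-cong pow-b≈w ≈-refl) (≡⇒≈ (ℤₚ.*-comm w (pow ℓ))))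

  pow-period : ∀ k → pow (k ℕ.* q) ≈ 1ℤ
  pow-period zero    = ≈-refl
  pow-period (suc k) = begin
    pow (q ℕ.+ k ℕ.* q)      ≡⟨ pow-+ q (k ℕ.* q) ⟩
    pow q * pow (k ℕ.* q)    ≈⟨ *-cong (%≡⇒≈ {g ℕ.^ q} {1} (proj₁ root)) (pow-period k) ⟩
    1ℤ                       ∎
    where open ≈-Reasoning

  pow-% : ∀ a → pow a ≈ pow (a % q)
  pow-% a = begin
    pow a                                ≡⟨ cong pow (ℕ.m≡m%n+[m/n]*n a q) ⟩
    pow (a % q ℕ.+ a / q ℕ.* q)          ≡⟨ pow-+ (a % q) (a / q ℕ.* q) ⟩
    pow (a % q) * pow (a / q ℕ.* q)      ≈⟨ *-cong {a = pow (a % q)} ≈-refl (pow-period (a / q)) ⟩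
    pow (a % q) * 1ℤ                     ≡⟨ ℤₚ.*-identityʳ (pow (a % q)) ⟩
    pow (a % q)                          ∎
    where open ≈-Reasoning

  pow≉0 : ∀ k → pow k ≉ 0ℤ
  pow≉0 k pow-k≈0 = positive-below-≉0 {1} (s≤s z≤n) (s≤s (ℕ.>-nonZero⁻¹ q)) (begin
    1ℤ                                     ≈⟨ pow-period k ⟨
    pow (k ℕ.* q)                          ≡⟨ cong (pow ∘ (k ℕ.*_)) (ℕ.suc-pred q) ⟨
    pow (k ℕ.* suc (ℕ.pred q))             ≡⟨ cong pow (ℕ.*-suc k (ℕ.pred q)) ⟩
    pow (k ℕ.+ k ℕ.* ℕ.pred q)             ≡⟨ pow-+ k (k ℕ.* ℕ.pred q) ⟩
    pow k * pow (k ℕ.* ℕ.pred q)           ≈⟨ *-cong pow-k≈0 ≈-refl ⟩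
    0ℤ * pow (k ℕ.* ℕ.pred q)              ≡⟨ ℤₚ.*-zeroˡ (pow (k ℕ.* ℕ.pred q)) ⟩
    0ℤ                                     ∎)
    where open ≈-Reasoning

  pow≈1⇒≡0 : ∀ {k} → k < q → pow k ≈ 1ℤ → k ≡ 0
  pow≈1⇒≡0 {zero}  _   _        = refl
  pow≈1⇒≡0 {suc k} k<q pow-k≈1 = contradiction (≈⇒%≡ pow-k≈1) (proj₂ root (suc k) (s≤s z≤n) k<q)

  pow-injective-below : ∀ {a b} → a < q → b < q → pow a ≈ pow b → a ≡ b
  pow-injective-below {a} {b} a<q b<q pow-a≈pow-b =
    [ (λ a≤b → ≤⇒≡ a≤b b<q pow-a≈pow-b) , (λ b≤a → sym (≤⇒≡ b≤a a<q (≈-sym pow-a≈pow-b))) ]′ (ℕ.≤-total a b)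
    where
      ≤⇒≡ : ∀ {a b} → a ≤ b → b < q → pow a ≈ pow b → a ≡ b
      ≤⇒≡ {a} {b} a≤b b<q pow-a≈pow-b = ℕ.≤-antisym a≤b (ℕ.m∸n≡0⇒m≤n
        (pow≈1⇒≡0 (ℕ.≤-<-trans (ℕ.m∸n≤m b a) b<q) (*-cancelˡ isPrime (pow≉0 a) (begin
          pow a * pow (b ℕ.∸ a)  ≡⟨ pow-+ a (b ℕ.∸ a) ⟨
          pow (a ℕ.+ (b ℕ.∸ a))  ≡⟨ cong pow (ℕ.m+[n∸m]≡n a≤b) ⟩
          pow b                  ≈⟨ pow-a≈pow-b ⟨
          pow a                  ≡⟨ ℤₚ.*-identityʳ (pow a) ⟨
          pow a * 1ℤ             ∎))))
        where open ≈-Reasoning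

  pow-≈⇔% : ∀ {a b} → pow a ≈ pow b ⇔ a % q ≡ b % q
  pow-≈⇔% {a} {b} = mk⇔
    (λ pow-a≈pow-b → pow-injective-below (ℕ.m%n<n a q) (ℕ.m%n<n b q)
                       (≈-trans (≈-sym (pow-% a)) (≈-trans pow-a≈pow-b (pow-% b))))
    (λ a%q≡b%q → ≈-trans (pow-% a) (≈-trans (≡⇒≈ (cong pow a%q≡b%q)) (≈-sym (pow-% b))))

  pow-±⇔% : ∀ a b → (pow a ≈ pow b ⊎ pow a ≈ - pow b) ⇔ a % n ≡ b % n
  pow-±⇔% a b = begin
    (pow a ≈ pow b ⊎ pow a ≈ - pow b)  ≈⟨ square-≈⇔ isPrime ⟨
    pow a * pow a ≈ pow b * pow b      ≈⟨ ≈-resp (≡⇒≈ (pow-double a)) (≡⇒≈ (pow-double b)) ⟨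
    pow (2 ℕ.* a) ≈ pow (2 ℕ.* b)      ≈⟨ pow-≈⇔% ⟩
    2 ℕ.* a % q ≡ 2 ℕ.* b % q          ≈⟨ %-double⇔ a b ⟨
    a % n ≡ b % n                      ∎
    where open ⇔-Reasoning

  pow-shift⇔ : ∀ a b {u w} ℓ → pow a ≈ u → pow b ≈ w →
               a % n ≡ (b ℕ.+ ℓ) % n ⇔ (u ≈ pow ℓ * w ⊎ u ≈ - pow ℓ * w)
  pow-shift⇔ a b {u} {w} ℓ pow-a≈u pow-b≈w = begin
    a % n ≡ (b ℕ.+ ℓ) % n                              ≈⟨ pow-±⇔% a (b ℕ.+ ℓ) ⟨
    (pow a ≈ pow (b ℕ.+ ℓ) ⊎ pow a ≈ - pow (b ℕ.+ ℓ))   ≈⟨ ≈-resp pow-a≈u shifted ⊎-⇔ ≈-resp pow-a≈u -shifted ⟩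
    (u ≈ pow ℓ * w ⊎ u ≈ - pow ℓ * w)                  ∎
    where
      open ⇔-Reasoning
      shifted : pow (b ℕ.+ ℓ) ≈ pow ℓ * w
      shifted = pow-+-cong {b} ℓ pow-b≈w
      -shifted : - pow (b ℕ.+ ℓ) ≈ - pow ℓ * w
      -shifted = ≈-trans (-‿cong shifted) (≡⇒≈ (ℤₚ.neg-distribˡ-* (pow ℓ) w))

module ConsecutiveRatios (n : ℕ) (isPrime : Prime (suc (2 ℕ.* n))) where

  open import Data.Integer using (_+_; _-_; _*_)
  open Modulo (suc (2 ℕ.* n))

  private
    p : ℕ
    p = suc (2 ℕ.* n)

    1<p : 1 < p
    1<p = ℕ.nonTrivial⇒n>1 p {{prime⇒nonTrivial isPrime}}

    2n∸n≡n : 2 ℕ.* n ℕ.∸ n ≡ n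
    2n∸n≡n = trans (ℕ.m+n∸m≡n n (n ℕ.+ 0)) (ℕ.+-identityʳ n)

    n≤2n : n ≤ 2 ℕ.* n
    n≤2n = ℕ.m≤m+n n (n ℕ.+ 0)

    n<p : n < p
    n<p = s≤s n≤2n

    <n⇒≤2n : ∀ {j} → j < n → j ≤ 2 ℕ.* n
    <n⇒≤2n j<n = ℕ.≤-trans (ℕ.<⇒≤ j<n) n≤2n

    reflection<p : ∀ j → 2 ℕ.* n ℕ.∸ j < p
    reflection<p j = s≤s (ℕ.m∸n≤m _ j)

    reflection-> : ∀ {j} → j < n → n < 2 ℕ.* n ℕ.∸ j
    reflection-> {j} j<n = subst (_< 2 ℕ.* n ℕ.∸ j) 2n∸n≡n (ℕ.∸-monoʳ-< j<n n≤2n)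

    reflection-< : ∀ {j} → n < j → j ≤ 2 ℕ.* n → 2 ℕ.* n ℕ.∸ j < n
    reflection-< {j} n<j j≤2n = subst (2 ℕ.* n ℕ.∸ j <_) 2n∸n≡n (ℕ.∸-monoʳ-< n<j j≤2n)

    ≉1⇒-1≉0 : ∀ {z} → z ≉ 1ℤ → z - 1ℤ ≉ 0ℤ
    ≉1⇒-1≉0 z≉1 = z≉1 ∘ difference≈0⇒≈

  Ratio : ℤ → ℕ → Set
  Ratio z i = + suc i ≈ z * + i

  InverseRatio : ℤ → ℕ → Set
  InverseRatio z i = + i ≈ z * + suc i

  RatioOrInverse : ℤ → ℕ → Set
  RatioOrInverse z i = Ratio z i ⊎ InverseRatio z i

  ratio⇔ : ∀ {z j} → Ratio z j ⇔ (z - 1ℤ) * + j ≈ 1ℤ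
  ratio⇔ {z} {j} = mk⇔
    (λ (mk≈ P∣r) → mk≈ (subst (+ p ∣_) (negate z (+ j)) (∣m⇒∣-m P∣r)))
    (λ (mk≈ P∣r) → mk≈ (subst (+ p ∣_) (negate′ z (+ j)) (∣m⇒∣-m P∣r)))
    where
      negate : ∀ z j → - ((1ℤ + j) - z * j) ≡ (z - 1ℤ) * j - 1ℤ
      negate = solve-∀
      negate′ : ∀ z j → - ((z - 1ℤ) * j - 1ℤ) ≡ (1ℤ + j) - z * j
      negate′ = solve-∀

  ratio-exists : ∀ {z} → z ≉ 1ℤ → ∃[ v ] v < p × Ratio z v
  ratio-exists {z} z≉1 =
    let w , [z-1]w≈1 = inverse isPrime (≉1⇒-1≉0 z≉1)
        v , v<p , w≈v = residue w
    in v , v<p , from (ratio⇔ {z}) (≈-trans (*-cong {a = z - 1ℤ} ≈-refl (≈-sym w≈v)) [z-1]w≈1)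

  ratio-unique : ∀ {z j k} → z ≉ 1ℤ → j < p → k < p → Ratio z j → Ratio z k → j ≡ k
  ratio-unique {z} z≉1 j<p k<p rj rk = ≈-injective-below j<p k<p
    (*-cancelˡ isPrime (≉1⇒-1≉0 z≉1) (≈-trans (to (ratio⇔ {z}) rj) (≈-sym (to (ratio⇔ {z}) rk))))

  ¬ratio-0 : ∀ {z} → ¬ Ratio z 0
  ¬ratio-0 {z} r = positive-below-≉0 (s≤s z≤n) 1<p (≈-trans r (≡⇒≈ (ℤₚ.*-zeroʳ z)))

  -- 2(n + 1) ≡ 1 and 2n ≡ -1, so n + 1 ≡ z n would give 1 ≡ -z.
  ¬ratio-n : ∀ {z} → z ≉ - 1ℤ → ¬ Ratio z n
  ¬ratio-n {z} z≉-1 (mk≈ P∣r) = z≉-1 (mk≈ (subst (+ p ∣_) (identity z (+ n))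
    (∣m∣n⇒∣m-n (∣n⇒∣m*n (+ 2) P∣r) (∣n⇒∣m*n (1ℤ - z) P∣1+2n))))
    where
      P∣1+2n : + p ∣ 1ℤ + + 2 * + n
      P∣1+2n = subst (+ p ∣_) (cong (λ u → 1ℤ + u) (ℤₚ.pos-* 2 n)) ∣-refl
      identity : ∀ z n → + 2 * ((1ℤ + n) - z * n) - (1ℤ - z) * (1ℤ + + 2 * n) ≡ z - - 1ℤ
      identity = solve-∀

  -- 2n ≡ -1, so 2n + 1 ≡ z 2n would give 0 ≡ -z.
  ¬ratio-2n : ∀ {z} → z ≉ 0ℤ → ¬ Ratio z (2 ℕ.* n)
  ¬ratio-2n {z} z≉0 (mk≈ P∣r) = z≉0 (mk≈ (subst (+ p ∣_) (identity z (+ (2 ℕ.* n)))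
    (∣m∣n⇒∣m-n P∣r (∣n⇒∣m*n (1ℤ - z) ∣-refl))))
    where
      identity : ∀ z m → ((1ℤ + m) - z * m) - (1ℤ - z) * (1ℤ + m) ≡ z - 0ℤ
      identity = solve-∀

  -- Modulo p, 2n - i ≡ -(i + 1) and (2n - i) + 1 ≡ -i.
  inverseRatio⇔ratio : ∀ {z i} → i ≤ 2 ℕ.* n → InverseRatio z i ⇔ Ratio z (2 ℕ.* n ℕ.∸ i)
  inverseRatio⇔ratio {z} {i} i≤2n = mk⇔ (λ (mk≈ h) → mk≈ (∣m+n∣m⇒∣n P∣sum h))
                                        (λ (mk≈ h) → mk≈ (∣m+n∣n⇒∣m P∣sum h))
    where
      j = 2 ℕ.* n ℕ.∸ i
      identity : ∀ z i j → (1ℤ - z) * (1ℤ + (j + i)) ≡ (i - z * (1ℤ + i)) + ((1ℤ + j) - z * j)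
      identity = solve-∀
      P∣sum : + p ∣ (+ i - z * + suc i) + (+ suc j - z * + j)
      P∣sum = subst (+ p ∣_)
        (trans (cong (λ k → (1ℤ - z) * + suc k) (sym (ℕ.m∸n+n≡m i≤2n))) (identity z (+ i) (+ j)))
        (∣n⇒∣m*n (1ℤ - z) ∣-refl)

  record LowerHalfSolution (z : ℤ) : Set where
    field
      index          : ℕ
      positive       : 0 < index
      below          : index < n
      characterises  : ∀ {j} → j < n → RatioOrInverse z j ⇔ j ≡ index

  -- The solution v of (v + 1)/v = z is neither 0, n nor 2n; if v > n, then 2n - v is the
  -- index in the lower half, as a solution of i/(i + 1) = z.
  lowerHalfSolution : ∀ {z} → z ≉ 0ℤ → z ≉ 1ℤ → z ≉ - 1ℤ → LowerHalfSolution z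
  lowerHalfSolution {z} z≉0 z≉1 z≉-1 = fromRatio (ratio-exists z≉1)
    where
      fromRatio : ∃[ v ] v < p × Ratio z v → LowerHalfSolution z
      fromRatio (v , v<p , rv) with ℕ.<-cmp v n
      ... | tri≈ _ refl _ = contradiction rv (¬ratio-n z≉-1)
      ... | tri< v<n _ _ = record
        { index = v ; positive = ℕ.n≢0⇒n>0 λ { refl → ¬ratio-0 {z} rv } ; below = v<n
        ; characterises = λ j<n → mk⇔ (unique j<n) λ { refl → inj₁ rv } }
        where
          unique : ∀ {j} → j < n → RatioOrInverse z j → j ≡ v
          unique j<n (inj₁ rj) = ratio-unique {z} z≉1 (ℕ.<-trans j<n n<p) v<p rj rv
          unique {j} j<n (inj₂ ij) = contradiction
            (ratio-unique {z} z≉1 (reflection<p j) v<p (to (inverseRatio⇔ratio {z} (<n⇒≤2n j<n)) ij) rv)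
            (ℕ.>⇒≢ (ℕ.<-trans v<n (reflection-> j<n)))
      ... | tri> _ _ n<v = record
        { index = 2 ℕ.* n ℕ.∸ v ; positive = ℕ.m<n⇒0<n∸m v<2n ; below = reflection-< n<v v≤2n
        ; characterises = λ j<n → mk⇔ (unique j<n) λ { refl → inj₂ (from (inverseRatio⇔ratio {z} (ℕ.m∸n≤m _ v))
                                       (subst (Ratio z) (sym (ℕ.m∸[m∸n]≡n v≤2n)) rv)) } }
        where
          v≤2n : v ≤ 2 ℕ.* n
          v≤2n = ℕ.s≤s⁻¹ v<p
          v<2n : v < 2 ℕ.* n
          v<2n = ℕ.≤∧≢⇒< v≤2n λ { refl → ¬ratio-2n z≉0 rv }
          unique : ∀ {j} → j < n → RatioOrInverse z j → j ≡ 2 ℕ.* n ℕ.∸ v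
          unique j<n (inj₁ rj) = contradiction
            (ratio-unique {z} z≉1 (ℕ.<-trans j<n n<p) v<p rj rv) (ℕ.<⇒≢ (ℕ.<-trans j<n n<v))
          unique {j} j<n (inj₂ ij) = trans (sym (ℕ.m∸[m∸n]≡n (<n⇒≤2n j<n))) (cong (2 ℕ.* n ℕ.∸_)
            (ratio-unique {z} z≉1 (reflection<p j) v<p (to (inverseRatio⇔ratio {z} (<n⇒≤2n j<n)) ij) rv))

  -- Equal ratios for y and -y force 2(i + 1) ≡ 0 or 2i ≡ 0; mixed ones force (1 + y²) i ≡ 0.
  ratioOrInverse-± : ∀ {y i} → y * y ≉ - 1ℤ → 0 < i → i < n →
                     RatioOrInverse y i → ¬ RatioOrInverse (- y) i
  ratioOrInverse-± {y} {i} y²≉-1 0<i i<n = excluded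
    where
      2i+2<p : suc i ℕ.+ suc i < p
      2i+2<p = s≤s (subst (suc i ℕ.+ suc i ≤_) (m+m≡2*m n) (ℕ.+-mono-≤ i<n i<n))
      2i<p : i ℕ.+ i < p
      2i<p = ℕ.<-trans (ℕ.+-mono-< (ℕ.n<1+n i) (ℕ.n<1+n i)) 2i+2<p
      no-root : ¬ + p ∣ (1ℤ + y * y) * + i
      no-root P∣ = [ y²≉-1 ∘ y²≈-1 , positive-below-≉0 0<i (ℕ.<-trans i<n n<p) ]′
                     (≈0-product isPrime (∣⇒≈0 P∣))
        where
          shift : ∀ y → (1ℤ + y * y) - 0ℤ ≡ y * y - - 1ℤ
          shift = solve-∀
          y²≈-1 : 1ℤ + y * y ≈ 0ℤ → y * y ≈ - 1ℤ
          y²≈-1 (mk≈ h) = mk≈ (subst (+ p ∣_) (shift y) h)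
      sum-ratios : ∀ y i → ((1ℤ + i) - y * i) + ((1ℤ + i) - - y * i) ≡ (1ℤ + i) + (1ℤ + i)
      sum-ratios = solve-∀
      sum-inverses : ∀ y i → (i - y * (1ℤ + i)) + (i - - y * (1ℤ + i)) ≡ i + i
      sum-inverses = solve-∀
      mixed : ∀ y i → (i - - y * (1ℤ + i)) - y * ((1ℤ + i) - y * i) ≡ (1ℤ + y * y) * i
      mixed = solve-∀
      mixed′ : ∀ y i → (i - y * (1ℤ + i)) + y * ((1ℤ + i) - - y * i) ≡ (1ℤ + y * y) * i
      mixed′ = solve-∀
      excluded : RatioOrInverse y i → ¬ RatioOrInverse (- y) i
      excluded (inj₁ (mk≈ r)) (inj₁ (mk≈ r′)) = positive-below-≉0 (s≤s z≤n) 2i+2<p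
        (∣⇒≈0 (subst (+ p ∣_) (sum-ratios y (+ i)) (∣m∣n⇒∣m+n r r′)))
      excluded (inj₂ (mk≈ s)) (inj₂ (mk≈ s′)) = positive-below-≉0 (ℕ.<-≤-trans 0<i (ℕ.m≤m+n i i)) 2i<p
        (∣⇒≈0 (subst (+ p ∣_) (sum-inverses y (+ i)) (∣m∣n⇒∣m+n s s′)))
      excluded (inj₁ (mk≈ r)) (inj₂ (mk≈ s′)) =
        no-root (subst (+ p ∣_) (mixed y (+ i)) (∣m∣n⇒∣m-n s′ (∣n⇒∣m*n y r)))
      excluded (inj₂ (mk≈ s)) (inj₁ (mk≈ r′)) =
        no-root (subst (+ p ∣_) (mixed′ y (+ i)) (∣m∣n⇒∣m+n s (∣n⇒∣m*n y r′)))

module DiscreteLogarithm (m : ℕ) where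

  open import Data.Integer using (_*_)

  n p : ℕ
  n = suc (2 ℕ.* m)
  p = suc (2 ℕ.* n)

  private
    suc≡⇔≡pred : ∀ {x i} → 0 < i → suc x ≡ i ⇔ x ≡ ℕ.pred i
    suc≡⇔≡pred {i = suc _} _ = mk⇔ ℕ.suc-injective (cong suc)

    pred-below : ∀ {i k} → 0 < i → i < suc k → ℕ.pred i < k
    pred-below {suc _} _ (s≤s i<k) = i<k

    pred-injective : ∀ {i j} → 0 < i → 0 < j → ℕ.pred i ≡ ℕ.pred j → i ≡ j
    pred-injective {suc _} {suc _} _ _ = cong suc

  module Residues (isPrime : Prime p) (g : ℕ) (root : PrimitiveRoot p g) (c : Fin n → ℕ)
                  (c-log : ∀ i → g ℕ.^ c i % p ≡ suc (toℕ i) % p) where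

    open Modulo p
    open PrimitiveRootPowers n isPrime g root
    open ConsecutiveRatios n isPrime
    private module Modₙ = Modulo n

    d : Fin n → ℕ
    d i = c i % n

    pow-c : ∀ i → pow (c i) ≈ + suc (toℕ i)
    pow-c i = %≡⇒≈ {g ℕ.^ c i} (c-log i)

    d-injective : ∀ s t → d s ≡ d t → s ≡ t
    d-injective s t ds≡dt = toℕ-injective (ℕ.suc-injective (±-injective bound
      (Sum.map (to (≈-resp (pow-c s) (pow-c t))) (to (≈-resp (pow-c s) (-‿cong (pow-c t))))
               (from (pow-±⇔% (c s) (c t)) ds≡dt))))
      where
        bound : suc (toℕ s) ℕ.+ suc (toℕ t) < p
        bound = s≤s (subst (suc (toℕ s) ℕ.+ suc (toℕ t) ≤_) (m+m≡2*m n) (ℕ.+-mono-≤ (toℕ<n s) (toℕ<n t)))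

    arrangement : IsArrangement m d
    arrangement = (λ t → ℕ.m%n<n (c t) n) , d-injective

    module _ (ℓ : ℕ) (1≤ℓ : 1 ≤ ℓ) (ℓ≤m : ℓ ≤ m) where

      private
        y : ℤ
        y = pow ℓ

        2ℓ<n : 2 ℕ.* ℓ < n
        2ℓ<n = s≤s (ℕ.*-monoʳ-≤ 2 ℓ≤m)

        ℓ<n : ℓ < n
        ℓ<n = ℕ.≤-<-trans (ℕ.m≤m+n ℓ (ℓ ℕ.+ 0)) 2ℓ<n

        y²≉1 : y * y ≉ 1ℤ
        y²≉1 y²≈1 = ℕ.>⇒≢ (ℕ.*-monoʳ-< 2 1≤ℓ)
          (pow≈1⇒≡0 (ℕ.<-≤-trans 2ℓ<n (ℕ.m≤m+n n (n ℕ.+ 0))) (≈-trans (≡⇒≈ (pow-double ℓ)) y²≈1))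

        y²≉-1 : y * y ≉ - 1ℤ
        y²≉-1 y²≈-1 = ℕ.>⇒≢ (ℕ.*-monoʳ-< 2 (ℕ.*-monoʳ-< 2 1≤ℓ))
          (pow≈1⇒≡0 (ℕ.*-monoʳ-< 2 2ℓ<n) (begin
            pow (2 ℕ.* (2 ℕ.* ℓ))                 ≡⟨ pow-double (2 ℕ.* ℓ) ⟩
            pow (2 ℕ.* ℓ) * pow (2 ℕ.* ℓ)         ≡⟨ cong₂ _*_ (pow-double ℓ) (pow-double ℓ) ⟩
            (y * y) * (y * y)                     ≈⟨ *-cong y²≈-1 y²≈-1 ⟩
            1ℤ                                    ∎))
          where open ≈-Reasoning

        ≉±1 : ∀ {z} → z * z ≡ y * y → z ≉ 1ℤ × z ≉ - 1ℤ
        ≉±1 z²≡y² = y²≉1 ∘ squared ∘ inj₁ , y²≉1 ∘ squared ∘ inj₂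
          where squared = ≈-trans (≡⇒≈ (sym z²≡y²)) ∘ from (square-≈⇔ isPrime)

        -y≉0 : - y ≉ 0ℤ
        -y≉0 -y≈0 = pow≉0 ℓ (≈-trans (≡⇒≈ (sym (ℤₚ.neg-involutive y))) (-‿cong -y≈0))

        neg-square : ∀ y → - y * - y ≡ y * y
        neg-square = solve-∀

        module S₊ = LowerHalfSolution (lowerHalfSolution (pow≉0 ℓ) (proj₁ (≉±1 refl)) (proj₂ (≉±1 refl)))
        module S₋ = LowerHalfSolution (lowerHalfSolution -y≉0 (proj₁ (≉±1 (neg-square y))) (proj₂ (≉±1 (neg-square y))))

      edge-length⇔ : ∀ t → let i = suc (toℕ t) in
                     T (hasLength m ℓ (d (inject₁ t)) (d (fsuc t))) ⇔ (RatioOrInverse y i ⊎ RatioOrInverse (- y) i)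
      edge-length⇔ t = begin
        T (hasLength m ℓ (d (inject₁ t)) (d (fsuc t)))
          ≈⟨ T-∨ ⟩
        (T (((c₁ % n ℕ.+ n) ℕ.∸ c₀ % n) % n ℕ.≡ᵇ ℓ) ⊎ T (((c₀ % n ℕ.+ n) ℕ.∸ c₁ % n) % n ℕ.≡ᵇ ℓ))
          ≈⟨ ≡ᵇ⇔≡ ⊎-⇔ ≡ᵇ⇔≡ ⟩
        (((c₁ % n ℕ.+ n) ℕ.∸ c₀ % n) % n ≡ ℓ ⊎ ((c₀ % n ℕ.+ n) ℕ.∸ c₁ % n) % n ≡ ℓ)
          ≈⟨ Modₙ.%-difference⇔ c₀ c₁ ℓ<n ⊎-⇔ Modₙ.%-difference⇔ c₁ c₀ ℓ<n ⟩
        (c₁ % n ≡ (c₀ ℕ.+ ℓ) % n ⊎ c₀ % n ≡ (c₁ ℕ.+ ℓ) % n)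
          ≈⟨ pow-shift⇔ c₁ c₀ ℓ (pow-c (fsuc t)) pow-c₀ ⊎-⇔ pow-shift⇔ c₀ c₁ ℓ pow-c₀ (pow-c (fsuc t)) ⟩
        ((Ratio y i ⊎ Ratio (- y) i) ⊎ (InverseRatio y i ⊎ InverseRatio (- y) i))
          ≈⟨ ⊎-interchange ⟩
        (RatioOrInverse y i ⊎ RatioOrInverse (- y) i)
          ∎
        where
          open ⇔-Reasoning
          i = suc (toℕ t)
          c₀ = c (inject₁ t)
          c₁ = c (fsuc t)
          pow-c₀ : pow c₀ ≈ + i
          pow-c₀ = subst (λ k → pow c₀ ≈ + suc k) (toℕ-inject₁ t) (pow-c (inject₁ t))

      edgeCount≡2 : edgeCount m d ℓ ≡ 2
      edgeCount≡2 = count≡2 (λ t → hasLength m ℓ (d (inject₁ t)) (d (fsuc t)))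
        distinct (pred-below S₊.positive S₊.below) (pred-below S₋.positive S₋.below) λ t → begin
          T (hasLength m ℓ (d (inject₁ t)) (d (fsuc t)))
            ≈⟨ edge-length⇔ t ⟩
          (RatioOrInverse y (suc (toℕ t)) ⊎ RatioOrInverse (- y) (suc (toℕ t)))
            ≈⟨ S₊.characterises (toℕ<n (fsuc t)) ⊎-⇔ S₋.characterises (toℕ<n (fsuc t)) ⟩
          (suc (toℕ t) ≡ S₊.index ⊎ suc (toℕ t) ≡ S₋.index)
            ≈⟨ suc≡⇔≡pred S₊.positive ⊎-⇔ suc≡⇔≡pred S₋.positive ⟩
          (toℕ t ≡ ℕ.pred S₊.index ⊎ toℕ t ≡ ℕ.pred S₋.index)
            ∎
        where
          open ⇔-Reasoning
          distinct : ℕ.pred S₊.index ≢ ℕ.pred S₋.index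
          distinct eq = ratioOrInverse-± {y} y²≉-1 S₊.positive S₊.below
            (from (S₊.characterises S₊.below) refl)
            (from (S₋.characterises S₊.below) (pred-injective S₊.positive S₋.positive eq))

open import Data.Nat using (_*_; _^_)

theorem2p3 : (m : ℕ) → Prime (suc (2 * suc (2 * m))) →
    (g : ℕ) → PrimitiveRoot (suc (2 * suc (2 * m))) g →
    (c : Fin (suc (2 * m)) → ℕ) →
    ((i : Fin (suc (2 * m))) → c i < 2 * suc (2 * m)) →
    ((i : Fin (suc (2 * m))) → g ^ c i % suc (2 * suc (2 * m)) ≡ suc (toℕ i) % suc (2 * suc (2 * m))) →
    Terrace m (λ i → c i % suc (2 * m))
theorem2p3 m isPrime g root c _ c-log = arrangement , edgeCount≡2
  where open DiscreteLogarithm.Residues m isPrime g root c c-log
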